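{- Let $(\delta,K_1,K_2,C_0,C_1)$ be admissible parameters satisfying Case II, put $C=\min(C_0,C_1)$, and let $M$ be a magic distance. Let $\mathbf C$ be a cycle of odd perimeter with distances $d_1,\dots,d_{2n+2},x_1,\dots,x_k$ (some $n\ge0$, $k\ge0$) such that $\sum_{i=1}^{2n+2}d_i>2K_2+n(C-1)+\sum_{i=1}^kx_i$, and suppose $\mathbf C$ is not a $C$-cycle. If $\mathbf C$ has at least 4 vertices, then $\mathbf C$ has a tension.
   Context: A $\delta$-edge-labelled cycle is a cycle graph (at least 3 vertices) with edge labels in $\{1,\dots,\delta\}$; it "has distances $d_1,\dots,d_m$" if its edges can be listed in some (arbitrary) order with these labels; its perimeter is the sum of labels. Two edges are neighbouring if they share a vertex. A $C$-cycle is a cycle which, for some $n'\ge0$, has distances $e_0,\dots,e_{2n'},y_1,\dots,y_m$ with $\sum_{i=0}^{2n'}e_i>n'(C-1)+\sum y_i$. Parameters: integers with $3\le\delta<\infty$, $1\le K_1\le K_2\le\delta$, $2\delta+2\le C_0,C_1\le3\delta+2$, $C_0$ even, $C_1$ odd; $C=\min(C_0,C_1)$, $C'=\max(C_0,C_1)$. Case II (admissible) means: $C\le2\delta+K_1$, $C=2K_1+2K_2+1$, $K_1+K_2\ge\delta$, $K_1+2K_2\le2\delta-1$, and either $C'=C+1$, or $C'>C+1$, $K_1=K_2$ and $3K_2=2\delta-1$. Magic distance (in Case II): $M\in\{1,\dots,\delta\}$ with $\max(K_1,\lceil\delta/2\rceil)\le M\le\min(K_2,\lfloor(C-\delta-1)/2\rfloor)$.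 Operation: $x\oplus y=|x-y|$ if $|x-y|>M$; otherwise $\min(x+y,C-1-x-y)$ if this is $<M$; otherwise $M$. A cycle has a tension if it has neighbouring edges with labels $a,b$ such that $a\oplus b\ne M$. -}

module Defs where

open import Data.Nat
open import Data.Bool using (if_then_else_)
open import Data.List using (List; []; _∷_; _++_; [_]; length)
open import Data.Nat.ListAction using (sum)
open import Data.List.Relation.Unary.All using (All)
open import Data.List.Relation.Binary.Permutation.Propositional using (_↭_)
open import Data.Product using (_×_; ∃; ∃-syntax; Σ-syntax; _,_)
open import Data.Sum using (_⊎_)
open import Relation.Binary.PropositionalEquality using (_≡_; _≢_)

-- A δ-edge-labelled cycle is represented by the list of its edge labels in
-- cyclic order (edge i and edge i+1 share a vertex, as do the last and first edge).
-- The number of vertices equals the number of edges = length of the list.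

Labelled : ℕ → List ℕ → Set
Labelled δ ls = All (λ a → 1 ≤ a × a ≤ δ) ls

IsCycle : ℕ → List ℕ → Set
IsCycle δ ls = 3 ≤ length ls × Labelled δ ls

perimeter : List ℕ → ℕ
perimeter = sum

HasDistances : List ℕ → List ℕ → Set
HasDistances ls ds = ds ↭ ls

Neighbouring : List ℕ → ℕ → ℕ → Set
Neighbouring ls a b =
  (∃[ pre ] ∃[ post ] ls ≡ pre ++ a ∷ b ∷ post)
  ⊎ (∃[ mid ] ls ≡ b ∷ (mid ++ [ a ]))

IsCCycle : ℕ → List ℕ → Set
IsCCycle C ls =
  ∃[ n' ] ∃[ e ] ∃[ y ]
    (length e ≡ 2 * n' + 1) × HasDistances ls (e ++ y) ×
    (n' * (C ∸ 1) + sum y < sum e)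

record CaseII (δ K₁ K₂ C₀ C₁ : ℕ) : Set where
  field
    δ≥3   : 3 ≤ δ
    K₁≥1  : 1 ≤ K₁
    K₁≤K₂ : K₁ ≤ K₂
    K₂≤δ  : K₂ ≤ δ
    C₀-lo : 2 * δ + 2 ≤ C₀
    C₀-hi : C₀ ≤ 3 * δ + 2
    C₁-lo : 2 * δ + 2 ≤ C₁
    C₁-hi : C₁ ≤ 3 * δ + 2
    C₀-even : C₀ % 2 ≡ 0
    C₁-odd  : C₁ % 2 ≡ 1
    c1 : C₀ ⊓ C₁ ≤ 2 * δ + K₁
    c2 : C₀ ⊓ C₁ ≡ 2 * K₁ + 2 * K₂ + 1
    c3 : δ ≤ K₁ + K₂
    c4 : K₁ + 2 * K₂ ≤ 2 * δ ∸ 1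
    c5 : (C₀ ⊔ C₁ ≡ (C₀ ⊓ C₁) + 1)
         ⊎ ((C₀ ⊓ C₁) + 1 < C₀ ⊔ C₁ × K₁ ≡ K₂ × 3 * K₂ ≡ 2 * δ ∸ 1)

IsMagic : (δ K₁ K₂ C M : ℕ) → Set
IsMagic δ K₁ K₂ C M =
  1 ≤ M × M ≤ δ ×
  K₁ ⊔ ⌈ δ /2⌉ ≤ M × M ≤ K₂ ⊓ ⌊ (C ∸ δ ∸ 1) /2⌋

-- the operation x ⊕ y (C - 1 - x - y is never negative for labels ≤ δ, since C ≥ 2δ+2)
op : (C M x y : ℕ) → ℕ
op C M x y =
  if M <ᵇ ∣ x - y ∣ then ∣ x - y ∣
  else (if ((x + y) ⊓ (C ∸ 1 ∸ (x + y))) <ᵇ M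
        then (x + y) ⊓ (C ∸ 1 ∸ (x + y))
        else M)

HasTension : (C M : ℕ) → List ℕ → Set
HasTension C M ls = ∃[ a ] ∃[ b ] Neighbouring ls a b × op C M a b ≢ M

-- Put H = K₁ + K₂, so that C − 1 = 2H and every label is at most δ ≤ H.  If
-- the neighbouring pairs (ℓ₀, ℓ₁) and (ℓ₂, ℓ₃) carry no tension, each satisfies
-- |a − b| ≤ M ≤ a + b and a + b + M ≤ 2H; as K₁ ≤ M ≤ K₂, however the pair is
-- distributed between d and x it contributes at least K₁ to
-- |d|·H + Σx − Σd, while every other label contributes at least 0.  Hence
-- Σd + 2K₁ ≤ (2n + 2)H + Σx = 2K₂ + n(C − 1) + Σx + 2K₁, against the
-- hypothesis.

module Submission where

open import Defs
open import Data.Nat using (ℕ; _≤_; _<_; _+_; _*_; _∸_; _⊓_; _%_)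
open import Data.List using (List; length; _++_)
open import Data.Nat.ListAction using (sum)
open import Relation.Binary.PropositionalEquality using (_≡_)
open import Relation.Nullary using (¬_)

open import Relation.Nullary using (yes; no)
open import Data.Bool using (true; false; T)
open import Data.Empty using (⊥-elim)
open import Data.List using ([]; _∷_; [_])
open import Data.List.Properties using (length-++)
open import Data.List.Relation.Unary.All using (All; []; _∷_)
import Data.List.Relation.Unary.All as All
open import Data.List.Relation.Unary.Any using (here)
open import Data.List.Membership.Propositional.Properties using (∈-∃++; ∈-++⁻)
open import Data.List.Relation.Binary.Permutation.Propositional
  using (_↭_; prep; ↭-sym; ↭-trans; ↭-refl)
open import Data.List.Relation.Binary.Permutation.Propositional.Properties
  using (∈-resp-↭; shift; drop-∷; ++⁺ˡ; ++⁺ʳ; ↭-length; ↭-empty-inv; ↭-singleton-inv)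
open import Data.Nat using (_≟_; _<ᵇ_; ∣_-_∣; z≤n; s≤s)
open import Data.Nat.ListAction.Properties using (sum-++; sum-↭)
open import Data.Nat.Properties
open import Algebra.Properties.CommutativeSemigroup +-commutativeSemigroup using (interchange)
open import Data.Nat.Tactic.RingSolver using (solve-∀)
open import Data.Product using (_×_; _,_; ∃-syntax)
open import Data.Sum using (_⊎_; inj₁; inj₂)
open import Data.Unit using (tt)
open import Relation.Binary.PropositionalEquality using (refl; sym; trans; cong; subst; subst₂)

module _ {A : Set} where

  ↭-∷-pick : ∀ {a : A} d x {ys} → d ++ x ↭ a ∷ ys →
             (∃[ d' ] d ↭ a ∷ d' × d' ++ x ↭ ys) ⊎ (∃[ x' ] x ↭ a ∷ x' × d ++ x' ↭ ys)
  ↭-∷-pick {a} d x p with ∈-++⁻ d (∈-resp-↭ (↭-sym p) (here refl))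
  ... | inj₁ a∈d with ∈-∃++ a∈d
  ...   | u , v , refl = inj₁ (u ++ v , shift a u v , drop-∷ (↭-trans (↭-sym (++⁺ʳ x (shift a u v))) p))
  ↭-∷-pick {a} d x p | inj₂ a∈x with ∈-∃++ a∈x
  ...   | u , v , refl = inj₂ (u ++ v , shift a u v , drop-∷ (↭-trans moved p))
    where
      moved : a ∷ d ++ u ++ v ↭ d ++ u ++ a ∷ v
      moved = ↭-trans (↭-sym (shift a d (u ++ v))) (++⁺ˡ d (↭-sym (shift a u v)))

  record SplitAlong (d x zs ys : List A) : Set where
    field
      d₁ d₂ x₁ x₂ : List A
      d↭ : d ↭ d₁ ++ d₂
      x↭ : x ↭ x₁ ++ x₂
      left : d₁ ++ x₁ ↭ zs
      right : d₂ ++ x₂ ↭ ys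

  ↭-++-split : ∀ zs {ys} d x → d ++ x ↭ zs ++ ys → SplitAlong d x zs ys
  ↭-++-split [] d x p = record
    { d₁ = [] ; d₂ = d ; x₁ = [] ; x₂ = x ; d↭ = ↭-refl ; x↭ = ↭-refl ; left = ↭-refl ; right = p }
  ↭-++-split (a ∷ zs) d x p with ↭-∷-pick d x p
  ... | inj₁ (d' , d↭a∷d' , q) =
        let open SplitAlong (↭-++-split zs d' x q)
        in record { d₁ = a ∷ d₁ ; d₂ = d₂ ; x₁ = x₁ ; x₂ = x₂
                  ; d↭ = ↭-trans d↭a∷d' (prep a d↭) ; x↭ = x↭ ; left = prep a left ; right = right }
  ... | inj₂ (x' , x↭a∷x' , q) =
        let open SplitAlong (↭-++-split zs d x' q)
        in record { d₁ = d₁ ; d₂ = d₂ ; x₁ = a ∷ x₁ ; x₂ = x₂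
                  ; d↭ = d↭ ; x↭ = ↭-trans x↭a∷x' (prep a x↭)
                  ; left = ↭-trans (shift a d₁ x₁) (prep a left) ; right = right }

module _ (H : ℕ) where

  Bounded : ℕ → List ℕ → Set
  Bounded s ys = ∀ d x → d ++ x ↭ ys → sum d + s ≤ length d * H + sum x

  +-mono-≤-interchange : ∀ {p P s S q Q r R} → p + s ≤ q + r → P + S ≤ Q + R →
                         (p + P) + (s + S) ≤ (q + Q) + (r + R)
  +-mono-≤-interchange {p} {P} {s} {S} {q} {Q} {r} {R} le LE =
    subst₂ _≤_ (interchange p s P S) (interchange q r Q R) (+-mono-≤ le LE)

  bounded-++ : ∀ {t s} zs {ys} → Bounded t zs → Bounded s ys → Bounded (t + s) (zs ++ ys)
  bounded-++ {t} {s} zs bzs bys d x p with ↭-++-split zs d x p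
  ... | record { d₁ = d₁ ; d₂ = d₂ ; x₁ = x₁ ; x₂ = x₂ ; d↭ = d↭ ; x↭ = x↭ ; left = left ; right = right }
    rewrite sum-↭ d↭ | sum-++ d₁ d₂ | ↭-length d↭ | length-++ d₁ {d₂} | *-distribʳ-+ H (length d₁) (length d₂)
          | sum-↭ x↭ | sum-++ x₁ x₂
    = +-mono-≤-interchange {sum d₁} {sum d₂} {t} {s} {length d₁ * H} {length d₂ * H} {sum x₁} {sum x₂}
        (bzs d₁ x₁ left) (bys d₂ x₂ right)

  bounded-singleton : ∀ {a} → a ≤ H → Bounded 0 [ a ]
  bounded-singleton a≤H d x p with d | ↭-singleton-inv p
  ... | [] | _ = z≤n
  ... | _ ∷ [] | refl = +-monoˡ-≤ 0 (+-monoˡ-≤ 0 a≤H)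

  bounded-all : ∀ {ys} → All (_≤ H) ys → Bounded 0 ys
  bounded-all [] d x p with d | ↭-empty-inv p
  ... | [] | _ = z≤n
  bounded-all (a≤H ∷ ys≤H) = bounded-++ [ _ ] (bounded-singleton a≤H) (bounded-all ys≤H)

  record Balanced (t a b : ℕ) : Set where
    constructor balanced
    field
      t≤a+b : t ≤ a + b
      a+t≤H+b : a + t ≤ H + b
      b+t≤H+a : b + t ≤ H + a
      a+b+t≤H+H : a + b + t ≤ H + H

  bounded-pair : ∀ {t a b} → Balanced t a b → Bounded t (a ∷ b ∷ [])
  bounded-pair {t} {a} {b} (balanced t≤a+b a+t≤H+b b+t≤H+a a+b+t≤H+H) d x p
    with ↭-++-split [ a ] d x p
  ... | record { d₁ = d₁ ; d₂ = d₂ ; x₁ = x₁ ; x₂ = x₂ ; d↭ = d↭ ; x↭ = x↭ ; left = left ; right = right }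
    rewrite sum-↭ d↭ | ↭-length d↭ | sum-↭ x↭
    with d₁ | x₁ | ↭-singleton-inv left | d₂ | x₂ | ↭-singleton-inv right
  ... | _ ∷ [] | [] | refl | _ ∷ [] | [] | refl
    rewrite +-identityʳ b | +-identityʳ H | +-identityʳ (H + H) = a+b+t≤H+H
  ... | _ ∷ [] | [] | refl | [] | _ | refl
    rewrite +-identityʳ a | +-identityʳ b | +-identityʳ H = a+t≤H+b
  ... | [] | _ | refl | _ ∷ [] | [] | refl
    rewrite +-identityʳ a | +-identityʳ b | +-identityʳ H = b+t≤H+a
  ... | [] | _ | refl | [] | _ | refl
    rewrite +-identityʳ b = t≤a+b

MagicPair : (C M a b : ℕ) → Set
MagicPair C M a b = ∣ a - b ∣ ≤ M × M ≤ a + b × a + b + M ≤ C ∸ 1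

op≡M⇒MagicPair : ∀ {C M} a b → 1 ≤ M → op C M a b ≡ M → MagicPair C M a b
op≡M⇒MagicPair {C} {M} a b 1≤M eq with M <ᵇ ∣ a - b ∣ in far
... | true = ⊥-elim (<-irrefl (sym eq) (<ᵇ⇒< M ∣ a - b ∣ (subst T (sym far) tt)))
... | false with (a + b) ⊓ (C ∸ 1 ∸ (a + b)) <ᵇ M in small
...   | true = ⊥-elim (<-irrefl eq (<ᵇ⇒< _ M (subst T (sym small) tt)))
...   | false = ∣a-b∣≤M , ≤-trans M≤⊓ (m⊓n≤m _ _) , a+b+M≤C∸1
  where
    ∣a-b∣≤M : ∣ a - b ∣ ≤ M
    ∣a-b∣≤M = ≮⇒≥ (λ lt → subst T far (<⇒<ᵇ lt))
    M≤⊓ : M ≤ (a + b) ⊓ (C ∸ 1 ∸ (a + b))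
    M≤⊓ = ≮⇒≥ (λ lt → subst T small (<⇒<ᵇ lt))
    M≤C∸1∸[a+b] : M ≤ C ∸ 1 ∸ (a + b)
    M≤C∸1∸[a+b] = ≤-trans M≤⊓ (m⊓n≤n _ _)
    -- 1 ≤ M rules out the truncated case C ∸ 1 ∸ (a + b) ≡ 0.
    a+b<C∸1 : a + b < C ∸ 1
    a+b<C∸1 = m∸n≢0⇒n<m (λ ≡0 → <-irrefl (sym ≡0) (≤-trans 1≤M M≤C∸1∸[a+b]))
    a+b+M≤C∸1 : a + b + M ≤ C ∸ 1
    a+b+M≤C∸1 = subst (_≤ C ∸ 1) (+-comm M (a + b)) (m≤o∸n⇒m+n≤o M (<⇒≤ a+b<C∸1) M≤C∸1∸[a+b])

module _ (K₁ K₂ : ℕ) where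

  private
    H : ℕ
    H = K₁ + K₂

  ∣m-n∣≤K₂⇒m+K₁≤H+n : ∀ {a b} → ∣ a - b ∣ ≤ K₂ → a + K₁ ≤ H + b
  ∣m-n∣≤K₂⇒m+K₁≤H+n {a} {b} ∣a-b∣≤K₂ = begin
    a + K₁          ≤⟨ +-monoˡ-≤ K₁ (≤-trans (m≤∣m-n∣+n a b) (+-monoˡ-≤ b ∣a-b∣≤K₂)) ⟩
    K₂ + b + K₁     ≡⟨ +-comm (K₂ + b) K₁ ⟩
    K₁ + (K₂ + b)   ≡⟨ +-assoc K₁ K₂ b ⟨
    H + b           ∎
    where open ≤-Reasoning

  magic⇒balanced : ∀ {C M a b} → K₁ ≤ M → M ≤ K₂ → C ∸ 1 ≡ H + H →
                   MagicPair C M a b → Balanced H K₁ a b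
  magic⇒balanced {M = M} {a} {b} K₁≤M M≤K₂ C∸1≡H+H (∣a-b∣≤M , M≤a+b , a+b+M≤C∸1) =
    balanced (≤-trans K₁≤M M≤a+b)
             (∣m-n∣≤K₂⇒m+K₁≤H+n (≤-trans ∣a-b∣≤M M≤K₂))
             (∣m-n∣≤K₂⇒m+K₁≤H+n (≤-trans (≤-reflexive (∣-∣-comm b a)) (≤-trans ∣a-b∣≤M M≤K₂)))
             (≤-trans (+-monoʳ-≤ (a + b) K₁≤M) (subst (a + b + M ≤_) C∸1≡H+H a+b+M≤C∸1))

  bounded⇒sum≤ : ∀ {ls} n d x → Bounded H (2 * K₁) ls → length d ≡ 2 * n + 2 → d ++ x ↭ ls →
                 sum d ≤ 2 * K₂ + n * (H + H) + sum x
  bounded⇒sum≤ n d x bounded |d|≡ p = +-cancelʳ-≤ (2 * K₁) (sum d) _ (begin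
    sum d + 2 * K₁                           ≤⟨ bounded d x p ⟩
    length d * H + sum x                     ≡⟨ cong (λ ℓ → ℓ * H + sum x) |d|≡ ⟩
    (2 * n + 2) * H + sum x                  ≡⟨ regroup n K₁ K₂ (sum x) ⟩
    2 * K₂ + n * (H + H) + sum x + 2 * K₁    ∎)
    where
      open ≤-Reasoning
      regroup : ∀ n k₁ k₂ s → (2 * n + 2) * (k₁ + k₂) + s ≡ 2 * k₂ + n * ((k₁ + k₂) + (k₁ + k₂)) + s + 2 * k₁
      regroup = solve-∀

  C∸1≡H+H : ∀ {C} → C ≡ 2 * K₁ + 2 * K₂ + 1 → C ∸ 1 ≡ H + H
  C∸1≡H+H refl = trans (m+n∸n≡m (2 * K₁ + 2 * K₂) 1) (double K₁ K₂)
    where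
      double : ∀ k₁ k₂ → 2 * k₁ + 2 * k₂ ≡ (k₁ + k₂) + (k₁ + k₂)
      double = solve-∀

mainTheorem9 : (δ K₁ K₂ C₀ C₁ M : ℕ) → CaseII δ K₁ K₂ C₀ C₁ →
    IsMagic δ K₁ K₂ (C₀ ⊓ C₁) M →
    (ls : List ℕ) → IsCycle δ ls → perimeter ls % 2 ≡ 1 →
    (n : ℕ) (d x : List ℕ) → length d ≡ 2 * n + 2 → HasDistances ls (d ++ x) →
    2 * K₂ + n * ((C₀ ⊓ C₁) ∸ 1) + sum x < sum d →
    ¬ IsCCycle (C₀ ⊓ C₁) ls →
    4 ≤ length ls →
    HasTension (C₀ ⊓ C₁) M ls
mainTheorem9 _ _ _ _ _ _ _ _ [] _ _ _ _ _ _ _ _ _ ()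
mainTheorem9 _ _ _ _ _ _ _ _ (_ ∷ []) _ _ _ _ _ _ _ _ _ (s≤s ())
mainTheorem9 _ _ _ _ _ _ _ _ (_ ∷ _ ∷ []) _ _ _ _ _ _ _ _ _ (s≤s (s≤s ()))
mainTheorem9 _ _ _ _ _ _ _ _ (_ ∷ _ ∷ _ ∷ []) _ _ _ _ _ _ _ _ _ (s≤s (s≤s (s≤s ())))
mainTheorem9 δ K₁ K₂ C₀ C₁ M case (1≤M , _ , K₁⊔≤M , M≤K₂⊓) ls@(a₀ ∷ a₁ ∷ a₂ ∷ a₃ ∷ rest)
             (_ , _ ∷ _ ∷ _ ∷ _ ∷ labels) _ n d x |d|≡ p excess _ _
  with op (C₀ ⊓ C₁) M a₀ a₁ ≟ M | op (C₀ ⊓ C₁) M a₂ a₃ ≟ M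
... | no tense | _ = a₀ , a₁ , inj₁ ([] , a₂ ∷ a₃ ∷ rest , refl) , tense
... | yes _ | no tense = a₂ , a₃ , inj₁ (a₀ ∷ a₁ ∷ [] , rest , refl) , tense
... | yes e₀₁ | yes e₂₃ = ⊥-elim (<⇒≱ excess (subst (λ c → sum d ≤ 2 * K₂ + n * c + sum x) (sym C∸1≡) sum-d≤))
  where
    open CaseII case
    H : ℕ
    H = K₁ + K₂
    C∸1≡ : C₀ ⊓ C₁ ∸ 1 ≡ H + H
    C∸1≡ = C∸1≡H+H K₁ K₂ c2
    pair-balanced : ∀ {a b} → op (C₀ ⊓ C₁) M a b ≡ M → Balanced H K₁ a b
    pair-balanced {a} {b} e =
      magic⇒balanced K₁ K₂ {C₀ ⊓ C₁} (m⊔n≤o⇒m≤o K₁ _ K₁⊔≤M) (m≤n⊓o⇒m≤n K₂ _ M≤K₂⊓) C∸1≡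
        (op≡M⇒MagicPair {C₀ ⊓ C₁} a b 1≤M e)
    labels≤H : All (_≤ H) rest
    labels≤H = All.map (λ (_ , a≤δ) → ≤-trans a≤δ c3) labels
    bounded : Bounded H (2 * K₁) ls
    bounded = bounded-++ H (a₀ ∷ a₁ ∷ []) (bounded-pair H (pair-balanced e₀₁))
                (bounded-++ H (a₂ ∷ a₃ ∷ []) (bounded-pair H (pair-balanced e₂₃)) (bounded-all H labels≤H))
    sum-d≤ : sum d ≤ 2 * K₂ + n * (H + H) + sum x
    sum-d≤ = bounded⇒sum≤ K₁ K₂ n d x bounded |d|≡ p
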